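{- Let $\ell$ be a positive integer. Take the vertex set of the complete graph $K_{4\ell}$ to be $\{x_i : i\in\mathbb{Z}_{2\ell}\}\cup\{y_i : i\in\mathbb{Z}_{2\ell}\}$, and let $L=\{1,2,\ldots,\ell\}$. Suppose $K_{4\ell}$ has 1-factors $F_1$ and $F_2$ such that (i) for each $d\in L$, $E(F_1)\cup E(F_2)$ contains exactly one edge of left pure length $d$ and exactly one edge of right pure length $d$, and for each $d\in\mathbb{Z}_{2\ell}$, $E(F_1)\cup E(F_2)$ contains exactly one edge of mixed difference $d$; and (ii) each of $F_1$ and $F_2$ contains exactly one edge of pure length $\ell$ (left or right). Then $K_{4\ell+1}^*$ admits a $(\vec{C}_2,\ldots,\vec{C}_2,\vec{C}_3)$-factorization.
   Context: For $i\in\mathbb{Z}_{k}$ and $d\in\{1,\ldots,\lfloor k/2\rfloor\}$, an edge $x_ix_{i+d}$ (resp. $y_iy_{i+d}$) of $K_{2k}$ on vertex set $\{x_i\}_{i\in\mathbb{Z}_k}\cup\{y_i\}_{i\in\mathbb{Z}_k}$ is called an edge of left (resp. right) pure length $d$; an edge $x_iy_{i+d}$ with $i,d\in\mathbb{Z}_k$ is called an edge of mixed difference $d$. Here $k=2\ell$. $K_n^*$ denotes the complete symmetric digraph on $n$ vertices. $\vec{C}_m$ denotes a directed cycle of length $m$ ($\vec{C}_2$ on $u,v$ is the pair of arcs $(u,v),(v,u)$). A $(\vec{C}_2,\ldots,\vec{C}_2,\vec{C}_3)$-factor of a digraph on $n$ vertices ($n$ odd) is a spanning subdigraph consisting of $(n-3)/2$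 directed 2-cycles and one directed 3-cycle, all pairwise vertex-disjoint; a $(\vec{C}_2,\ldots,\vec{C}_2,\vec{C}_3)$-factorization is a partition of the arc set into such factors. -}

module Defs where

open import Data.Nat using (ℕ; _+_; _*_; _≤_)
open import Data.Fin using (Fin; toℕ)
open import Data.Product using (_×_; _,_; Σ; ∃)
open import Data.Sum using (_⊎_)
open import Relation.Binary.PropositionalEquality using (_≡_; _≢_)

-- Z_k is represented by Fin k.  "b = a + d in Z_k" (a, b < k, d < k):
AddMod : (k : ℕ) → Fin k → ℕ → Fin k → Set
AddMod k a d b = (toℕ a + d ≡ toℕ b) ⊎ (toℕ a + d ≡ toℕ b + k)

-- Vertices of K_{2k}: x_i = (X , i), y_i = (Y , i), i ∈ Z_k.
data Side : Set where
  X Y : Side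

Vtx : ℕ → Set
Vtx k = Side × Fin k

-- Edges are unordered; an edge {u , v} is handled via ordered pairs,
-- with all predicates below symmetric.  Two ordered pairs give the same edge:
SameEdge : ∀ {k} → Vtx k → Vtx k → Vtx k → Vtx k → Set
SameEdge u v u' v' = (u ≡ u' × v ≡ v') ⊎ (u ≡ v' × v ≡ u')

data PureStep (s : Side) (k d : ℕ) : Vtx k → Vtx k → Set where
  pstep : ∀ {a b} → AddMod k a d b → PureStep s k d (s , a) (s , b)

-- edge {u , v} has pure length d on side s (s = X : left, s = Y : right)
PureLength : Side → (k d : ℕ) → Vtx k → Vtx k → Set
PureLength s k d u v = PureStep s k d u v ⊎ PureStep s k d v u

data MixedStep (k : ℕ) (d : Fin k) : Vtx k → Vtx k → Set where
  mstep : ∀ {a b} → AddMod k a (toℕ d) b → MixedStep k d (X , a) (Y , b)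

MixedDiff : (k : ℕ) → Fin k → Vtx k → Vtx k → Set
MixedDiff k d u v = MixedStep k d u v ⊎ MixedStep k d v u

-- A 1-factor (perfect matching) of K_{2k}: a fixed-point-free involution m;
-- its edges are {v , m v}.
IsOneFactor : ∀ {k} → (Vtx k → Vtx k) → Set
IsOneFactor {k} m = (∀ v → m (m v) ≡ v) × (∀ v → m v ≢ v)

InFactor : ∀ {k} → (Vtx k → Vtx k) → Vtx k → Vtx k → Set
InFactor m u v = m u ≡ v

InUnion : ∀ {k} → (Vtx k → Vtx k) → (Vtx k → Vtx k) → Vtx k → Vtx k → Set
InUnion m₁ m₂ u v = InFactor m₁ u v ⊎ InFactor m₂ u v

ExactlyOneEdge : ∀ {k} → (E P : Vtx k → Vtx k → Set) → Set
ExactlyOneEdge {k} E P =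
  Σ (Vtx k) (λ u → Σ (Vtx k) (λ v → E u v × P u v)) ×
  (∀ u v u' v' → E u v → P u v → E u' v' → P u' v' → SameEdge u v u' v')

-- Complete symmetric digraph K_n^* on vertex set Fin n; arcs (u , v), u ≢ v.
-- A spanning subdigraph that is a vertex-disjoint union of directed cycles
-- covering every vertex is given by its successor function σ (arcs (v , σ v)).
-- (C₂,…,C₂,C₃)-factor: one directed 3-cycle a → b → c → a on distinct
-- vertices, every other vertex on a directed 2-cycle v → σ v → v.
IsC2C3Factor : (n : ℕ) → (Fin n → Fin n) → Set
IsC2C3Factor n σ =
  Σ (Fin n) λ a → Σ (Fin n) λ b → Σ (Fin n) λ c →
    (a ≢ b) × (b ≢ c) × (a ≢ c) ×
    (σ a ≡ b) × (σ b ≡ c) × (σ c ≡ a) ×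
    (∀ v → v ≢ a → v ≢ b → v ≢ c → (σ v ≢ v) × (σ (σ v) ≡ v))

C2C3Factorization : ℕ → Set
C2C3Factorization n =
  Σ ℕ λ t → Σ (Fin t → Fin n → Fin n) λ F →
    (∀ i → IsC2C3Factor n (F i)) ×
    (∀ u v → u ≢ v →
       Σ (Fin t) (λ i → F i u ≡ v) ×
       (∀ i j → F i u ≡ v → F j u ≡ v → i ≡ j))

-- Adjoin a point ∞ to the vertices of K_{4ℓ}. Replacing the long edge pq of F_j by the directed
-- triangle ∞ → p → q → ∞ and every other edge of F_j by a directed 2-cycle gives a
-- (C₂,…,C₂,C₃)-factor of K*_{4ℓ+1}; its 2ℓ translates (x_i, y_i ↦ x_{i+r}, y_{i+r}) for j = 1, 2
-- partition the arcs. An arc w → z avoiding ∞ lies in a translate exactly when the unique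
-- edge of F₁ ∪ F₂ with the difference class of {w, z} is carried onto {w, z}. For a short class
-- this happens for exactly one translation, since 2d ≢ 0 mod 2ℓ; for the long class (ℓ ≡ −ℓ) the
-- one arc p → q of the triangle already reaches every arc of its side, and the arcs at ∞ are
-- covered once because, by (i) and (ii), the two long edges lie on different sides. Uniqueness of
-- the factor also needs F₁ and F₂ to be edge-disjoint, which follows by counting: F₁ ∪ F₂ has one
-- edge per difference class, 4ℓ edges in all, as many as F₁ and F₂ together.

module Submission where

open import Data.Bool using (Bool; true; false; not)
open import Data.Bool.Properties using (not-¬)
open import Data.Empty using (⊥; ⊥-elim)
open import Data.Fin as Fin using (Fin; toℕ; fromℕ<; punchOut)
import Data.Fin.Properties as Finₚ
open import Data.Maybe using (Maybe; just; nothing)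
import Data.Maybe as Maybe
open import Data.Maybe.Properties using (just-injective)
open import Data.Nat using (ℕ; zero; suc; _+_; _*_; _∸_; _≤_; _<_; _<?_; s≤s; z≤n; NonZero)
open import Data.Nat.DivMod
open import Data.Nat.Properties
open import Algebra.Properties.CommutativeSemigroup +-commutativeSemigroup
  using (xy∙z≈xz∙y; xy∙z≈y∙xz; x∙yz≈y∙xz)
open import Data.Nat.Tactic.RingSolver using (solve-∀)
open import Data.Product using (_×_; Σ; _,_; proj₁; proj₂; map₂) renaming (swap to ×-swap)
import Data.Product.Properties as ×ₚ
open import Data.Product.Function.NonDependent.Propositional using (_×-↔_)
open import Data.Sum using (_⊎_; inj₁; inj₂)
import Data.Sum as Sum
open import Data.Sum.Function.Propositional using (_⊎-↔_)
open import Function using (_∘_)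
open import Function.Bundles using (_↔_; Inverse; mk↔ₛ′)
open import Function.Definitions using (Injective)
open import Function.Properties.Inverse using (↔-trans; ↔-sym; ↔-refl)
open import Relation.Binary.Bundles using (Setoid)
import Relation.Binary.Reasoning.Setoid
open import Relation.Nullary using (¬_; Dec; yes; no)
open import Relation.Binary.PropositionalEquality
open import Defs

IsC2C3FactorOn : (A : Set) → (A → A) → Set
IsC2C3FactorOn A σ =
  Σ A λ a → Σ A λ b → Σ A λ c →
    (a ≢ b) × (b ≢ c) × (a ≢ c) ×
    (σ a ≡ b) × (σ b ≡ c) × (σ c ≡ a) ×
    (∀ v → v ≢ a → v ≢ b → v ≢ c → (σ v ≢ v) × (σ (σ v) ≡ v))

ArcPartition : (A I : Set) → (I → A → A) → Set
ArcPartition A I F =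
  ∀ u v → u ≢ v → Σ I (λ i → F i u ≡ v) × (∀ i j → F i u ≡ v → F j u ≡ v → i ≡ j)

module _ {A B : Set} (φ : A ↔ B) where
  open Inverse φ

  from-injective : ∀ {x y} → from x ≡ from y → x ≡ y
  from-injective {x} {y} e = trans (sym (strictlyInverseˡ x)) (trans (cong to e) (strictlyInverseˡ y))

  to-injective : ∀ {x y} → to x ≡ to y → x ≡ y
  to-injective {x} {y} e = trans (sym (strictlyInverseʳ x)) (trans (cong from e) (strictlyInverseʳ y))

  IsC2C3FactorOn-conjugate : ∀ {σ} → IsC2C3FactorOn A σ → IsC2C3FactorOn B (to ∘ σ ∘ from)
  IsC2C3FactorOn-conjugate {σ} (a , b , c , a≢b , b≢c , a≢c , σa , σb , σc , twoCycles) =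
    to a , to b , to c , to-≢ a≢b , to-≢ b≢c , to-≢ a≢c ,
    arc σa , arc σb , arc σc , twoCycle
    where
    to-≢ : ∀ {x y} → x ≢ y → to x ≢ to y
    to-≢ x≢y = x≢y ∘ to-injective
    from-≢ : ∀ {v x} → v ≢ to x → from v ≢ x
    from-≢ {v} v≢ e = v≢ (trans (sym (strictlyInverseˡ v)) (cong to e))
    arc : ∀ {x y} → σ x ≡ y → to (σ (from (to x))) ≡ to y
    arc {x} e = trans (cong (to ∘ σ) (strictlyInverseʳ x)) (cong to e)
    twoCycle : ∀ v → v ≢ to a → v ≢ to b → v ≢ to c →
               (to (σ (from v)) ≢ v) × (to (σ (from (to (σ (from v))))) ≡ v)
    twoCycle v va vb vc =
      (λ e → moves (trans (sym (strictlyInverseʳ _)) (cong from e))) ,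
      trans (cong (to ∘ σ) (strictlyInverseʳ _)) (trans (cong to returns) (strictlyInverseˡ v))
      where
      moves = proj₁ (twoCycles (from v) (from-≢ va) (from-≢ vb) (from-≢ vc))
      returns = proj₂ (twoCycles (from v) (from-≢ va) (from-≢ vb) (from-≢ vc))

module _ {A I : Set} {n t : ℕ} (φ : A ↔ Fin n) (ψ : I ↔ Fin t) (F : I → A → A) where
  open Inverse

  C2C3Factorization-transport :
    (∀ i → IsC2C3FactorOn A (F i)) → ArcPartition A I F → C2C3Factorization n
  C2C3Factorization-transport factor partition =
    t , F′ , (λ i → IsC2C3FactorOn-conjugate φ (factor (from ψ i))) , partition′
    where
    F′ : Fin t → Fin n → Fin n
    F′ i = to φ ∘ F (from ψ i) ∘ from φ
    F′-arc : ∀ {i u v} → F′ i u ≡ v → F (from ψ i) (from φ u) ≡ from φ v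
    F′-arc e = trans (sym (strictlyInverseʳ φ _)) (cong (from φ) e)
    partition′ : ∀ u v → u ≢ v →
                 Σ (Fin t) (λ i → F′ i u ≡ v) × (∀ i j → F′ i u ≡ v → F′ j u ≡ v → i ≡ j)
    partition′ u v u≢v with partition (from φ u) (from φ v) (u≢v ∘ from-injective φ)
    ... | (i , e) , unique =
      (to ψ i , trans (cong (λ i′ → to φ (F i′ (from φ u))) (strictlyInverseʳ ψ i))
                      (trans (cong (to φ) e) (strictlyInverseˡ φ v))) ,
      λ i′ j′ e₁ e₂ → from-injective ψ (unique _ _ (F′-arc e₁) (F′-arc e₂))

injective-misses-nothing : ∀ {n} (f : Fin n → Fin n) → Injective _≡_ _≡_ f →
                           ∀ y → ¬ (∀ x → f x ≢ y)
injective-misses-nothing {zero} f _ ()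
injective-misses-nothing {suc n} f f-injective y missed =
  1+n≰n (Finₚ.injective⇒≤ punched-injective)
  where
  punched : Fin (suc n) → Fin n
  punched x = punchOut (missed x ∘ sym)
  punched-injective : Injective _≡_ _≡_ punched
  punched-injective {x} {x′} e =
    f-injective (Finₚ.punchOut-injective (missed x ∘ sym) (missed x′ ∘ sym) e)

↔-injective-misses-nothing : ∀ {A B : Set} {n} → A ↔ Fin n → B ↔ Fin n →
  (g : A → B) → Injective _≡_ _≡_ g → ∀ b → ¬ (∀ a → g a ≢ b)
↔-injective-misses-nothing φ ψ g g-injective b missed =
  injective-misses-nothing (to ψ ∘ g ∘ from φ)
    (from-injective φ ∘ g-injective ∘ to-injective ψ) (to ψ b)
    (λ x e → missed (from φ x) (to-injective ψ e))
  where open Inverse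

_≟Side_ : (s t : Side) → Dec (s ≡ t)
X ≟Side X = yes refl
X ≟Side Y = no λ ()
Y ≟Side X = no λ ()
Y ≟Side Y = yes refl

other : Side → Side
other X = Y
other Y = X

other≢ : ∀ s → s ≢ other s
other≢ X ()
other≢ Y ()

PureStep-source-side : ∀ {s n d u v} → PureStep s n d u v → proj₁ u ≡ s
PureStep-source-side (pstep _) = refl

PureStep-target-side : ∀ {s n d u v} → PureStep s n d u v → proj₁ v ≡ s
PureStep-target-side (pstep _) = refl

_≟Vtx_ : ∀ {n} (u v : Vtx n) → Dec (u ≡ v)
_≟Vtx_ = ×ₚ.≡-dec _≟Side_ Finₚ._≟_

Side↔Fin2 : Side ↔ Fin 2
Side↔Fin2 = mk↔ₛ′
  (λ { X → Fin.zero ; Y → Fin.suc Fin.zero }) (λ { Fin.zero → X ; (Fin.suc Fin.zero) → Y })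
  (λ { Fin.zero → refl ; (Fin.suc Fin.zero) → refl }) (λ { X → refl ; Y → refl })

Vtx↔Fin : ∀ n → Vtx n ↔ Fin (2 * n)
Vtx↔Fin n = ↔-trans (Side↔Fin2 ×-↔ ↔-refl) (↔-sym Finₚ.*↔×)

Maybe↔Fin : ∀ {A : Set} {n} → A ↔ Fin n → Maybe A ↔ Fin (suc n)
Maybe↔Fin {A} {n} φ = mk↔ₛ′ to′ from′ to∘from from∘to
  where
  open Inverse φ
  to′ : Maybe A → Fin (suc n)
  to′ nothing = Fin.zero
  to′ (just a) = Fin.suc (to a)
  from′ : Fin (suc n) → Maybe A
  from′ Fin.zero = nothing
  from′ (Fin.suc i) = just (from i)
  to∘from : ∀ i → to′ (from′ i) ≡ i
  to∘from Fin.zero = refl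
  to∘from (Fin.suc i) = cong Fin.suc (strictlyInverseˡ i)
  from∘to : ∀ a → from′ (to′ a) ≡ a
  from∘to nothing = refl
  from∘to (just a) = cong just (strictlyInverseʳ a)

×Bool↔Fin : ∀ {A : Set} {n} → A ↔ Fin n → (A × Bool) ↔ Fin (n * 2)
×Bool↔Fin φ = ↔-trans (φ ×-↔ ↔-sym Finₚ.2↔Bool) (↔-sym Finₚ.*↔×)

-- Arithmetic modulo k

module Modular (k : ℕ) .{{_ : NonZero k}} where

  infix 4 _≈_
  record _≈_ (x y : ℕ) : Set where
    constructor mk≈
    field %-≡ : x % k ≡ y % k

  ≈-refl : ∀ {x} → x ≈ x
  ≈-refl = mk≈ refl

  ≈-sym : ∀ {x y} → x ≈ y → y ≈ x
  ≈-sym (mk≈ e) = mk≈ (sym e)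

  ≈-trans : ∀ {x y z} → x ≈ y → y ≈ z → x ≈ z
  ≈-trans (mk≈ e) (mk≈ f) = mk≈ (trans e f)

  ≈-reflexive : ∀ {x y} → x ≡ y → x ≈ y
  ≈-reflexive e = mk≈ (cong (_% k) e)

  ≈-setoid : Setoid _ _
  ≈-setoid = record
    { Carrier = ℕ
    ; _≈_ = _≈_
    ; isEquivalence = record { refl = ≈-refl ; sym = ≈-sym ; trans = ≈-trans }
    }

  module ≈-Reasoning = Relation.Binary.Reasoning.Setoid ≈-setoid

  +-cong : ∀ {x x′ y y′} → x ≈ x′ → y ≈ y′ → x + y ≈ x′ + y′
  +-cong {x} {x′} {y} {y′} (mk≈ e) (mk≈ f) = mk≈ (begin
    (x + y) % k             ≡⟨ %-distribˡ-+ x y k ⟩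
    (x % k + y % k) % k     ≡⟨ cong₂ (λ a b → (a + b) % k) e f ⟩
    (x′ % k + y′ % k) % k   ≡⟨ %-distribˡ-+ x′ y′ k ⟨
    (x′ + y′) % k           ∎)
    where open ≡-Reasoning

  +-congˡ : ∀ {x y y′} → y ≈ y′ → x + y ≈ x + y′
  +-congˡ = +-cong ≈-refl

  +-congʳ : ∀ {x x′ y} → x ≈ x′ → x + y ≈ x′ + y
  +-congʳ e = +-cong e ≈-refl

  m+k≈m : ∀ x → x + k ≈ x
  m+k≈m x = mk≈ ([m+n]%n≡m%n x k)

  m%k≈m : ∀ x → x % k ≈ x
  m%k≈m x = mk≈ (m%n%n≡m%n x k)

  k≈0 : k ≈ 0
  k≈0 = m+k≈m 0

  <k⇒≈⇒≡ : ∀ {x y} → x < k → y < k → x ≈ y → x ≡ y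
  <k⇒≈⇒≡ x<k y<k (mk≈ e) = trans (sym (m<n⇒m%n≡m x<k)) (trans e (m<n⇒m%n≡m y<k))

  +-complement≈0 : ∀ z → z + (k ∸ z % k) ≈ 0
  +-complement≈0 z = ≈-trans (≈-reflexive z+c≡) (mk≈ ([m+kn]%n≡m%n 0 (suc (z / k)) k))
    where
    open ≡-Reasoning
    z+c≡ : z + (k ∸ z % k) ≡ 0 + suc (z / k) * k
    z+c≡ = begin
      z + (k ∸ z % k)                    ≡⟨ cong (_+ (k ∸ z % k)) (m≡m%n+[m/n]*n z k) ⟩
      (z % k + z / k * k) + (k ∸ z % k)  ≡⟨ regroup (z % k) (z / k * k) (k ∸ z % k) ⟩
      (z % k + (k ∸ z % k)) + z / k * k  ≡⟨ cong (_+ z / k * k) (m+[n∸m]≡n (<⇒≤ (m%n<n z k))) ⟩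
      k + z / k * k                      ∎
      where
      regroup : ∀ a b c → (a + b) + c ≡ (a + c) + b
      regroup = solve-∀

  ≈-cancelˡ : ∀ {x y} z → z + x ≈ z + y → x ≈ y
  ≈-cancelˡ {x} {y} z e = begin
    x                ≡⟨ +-identityˡ x ⟨
    0 + x            ≈⟨ +-congʳ (+-complement≈0 z) ⟨
    (z + c) + x      ≡⟨ xy∙z≈y∙xz z c x ⟩
    c + (z + x)      ≈⟨ +-congˡ {c} e ⟩
    c + (z + y)      ≡⟨ xy∙z≈y∙xz z c y ⟨
    (z + c) + y      ≈⟨ +-congʳ (+-complement≈0 z) ⟩
    0 + y            ≡⟨ +-identityˡ y ⟩
    y                ∎
    where
    open ≈-Reasoning
    c = k ∸ z % k

  toℕ-mod : ∀ x → toℕ (x mod k) ≈ x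
  toℕ-mod x = ≈-trans (≈-reflexive (Finₚ.toℕ-fromℕ< (m%n<n x k))) (m%k≈m x)

  toℕ-≈-injective : ∀ {a b : Fin k} → toℕ a ≈ toℕ b → a ≡ b
  toℕ-≈-injective {a} {b} e = Finₚ.toℕ-injective (<k⇒≈⇒≡ (Finₚ.toℕ<n a) (Finₚ.toℕ<n b) e)

  infixl 6 _⊕_
  _⊕_ : Fin k → Fin k → Fin k
  a ⊕ b = (toℕ a + toℕ b) mod k

  ⊖_ : Fin k → Fin k
  ⊖ a = (k ∸ toℕ a) mod k

  toℕ-⊕ : ∀ a b → toℕ (a ⊕ b) ≈ toℕ a + toℕ b
  toℕ-⊕ a b = toℕ-mod _

  +-⊖≈0 : ∀ a → toℕ a + toℕ (⊖ a) ≈ 0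
  +-⊖≈0 a = begin
    toℕ a + toℕ (⊖ a)    ≈⟨ +-congˡ {toℕ a} (toℕ-mod (k ∸ toℕ a)) ⟩
    toℕ a + (k ∸ toℕ a)  ≡⟨ m+[n∸m]≡n (<⇒≤ (Finₚ.toℕ<n a)) ⟩
    k                    ≈⟨ k≈0 ⟩
    0                    ∎
    where open ≈-Reasoning

  toℕ-+-⊖ : ∀ a b → toℕ a + toℕ (b ⊕ ⊖ a) ≈ toℕ b
  toℕ-+-⊖ a b = begin
    toℕ a + toℕ (b ⊕ ⊖ a)          ≈⟨ +-congˡ {toℕ a} (toℕ-⊕ b (⊖ a)) ⟩
    toℕ a + (toℕ b + toℕ (⊖ a))    ≡⟨ x∙yz≈y∙xz (toℕ a) (toℕ b) (toℕ (⊖ a)) ⟩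
    toℕ b + (toℕ a + toℕ (⊖ a))    ≈⟨ +-congˡ {toℕ b} (+-⊖≈0 a) ⟩
    toℕ b + 0                      ≡⟨ +-identityʳ (toℕ b) ⟩
    toℕ b                          ∎
    where open ≈-Reasoning

  ⊕-⊖-cancel : ∀ a r → a ⊕ r ⊕ ⊖ r ≡ a
  ⊕-⊖-cancel a r = toℕ-≈-injective (begin
    toℕ (a ⊕ r ⊕ ⊖ r)                ≈⟨ toℕ-⊕ (a ⊕ r) (⊖ r) ⟩
    toℕ (a ⊕ r) + toℕ (⊖ r)          ≈⟨ +-congʳ (toℕ-⊕ a r) ⟩
    toℕ a + toℕ r + toℕ (⊖ r)        ≡⟨ +-assoc (toℕ a) _ _ ⟩
    toℕ a + (toℕ r + toℕ (⊖ r))      ≈⟨ +-congˡ {toℕ a} (+-⊖≈0 r) ⟩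
    toℕ a + 0                        ≡⟨ +-identityʳ (toℕ a) ⟩
    toℕ a                            ∎)
    where open ≈-Reasoning

  ⊖-involutive : ∀ r → ⊖ ⊖ r ≡ r
  ⊖-involutive r = toℕ-≈-injective (≈-cancelˡ (toℕ (⊖ r)) (begin
    toℕ (⊖ r) + toℕ (⊖ ⊖ r)  ≈⟨ +-⊖≈0 (⊖ r) ⟩
    0                        ≈⟨ +-⊖≈0 r ⟨
    toℕ r + toℕ (⊖ r)        ≡⟨ +-comm (toℕ r) _ ⟩
    toℕ (⊖ r) + toℕ r        ∎))
    where open ≈-Reasoning

  ⊖-injective : ∀ {r r′} → ⊖ r ≡ ⊖ r′ → r ≡ r′
  ⊖-injective {r} {r′} e = trans (sym (⊖-involutive r)) (trans (cong ⊖_ e) (⊖-involutive r′))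

  ⊕-⊖-cancel′ : ∀ a r → a ⊕ ⊖ r ⊕ r ≡ a
  ⊕-⊖-cancel′ a r = trans (cong (a ⊕ ⊖ r ⊕_) (sym (⊖-involutive r))) (⊕-⊖-cancel a (⊖ r))

  AddMod⇒≈ : ∀ {a d b} → AddMod k a d b → toℕ a + d ≈ toℕ b
  AddMod⇒≈ (inj₁ e) = ≈-reflexive e
  AddMod⇒≈ {b = b} (inj₂ e) = ≈-trans (≈-reflexive e) (m+k≈m (toℕ b))

  ≈⇒AddMod : ∀ {a d b} → d ≤ k → toℕ a + d ≈ toℕ b → AddMod k a d b
  ≈⇒AddMod {a} {d} {b} d≤k e with toℕ a + d <? k
  ... | yes a+d<k = inj₁ (<k⇒≈⇒≡ a+d<k (Finₚ.toℕ<n b) e)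
  ... | no a+d≮k = inj₂ (trans (sym (m∸n+n≡m k≤a+d)) (cong (_+ k) wrapped))
    where
    k≤a+d : k ≤ toℕ a + d
    k≤a+d = ≮⇒≥ a+d≮k
    wrapped<k : toℕ a + d ∸ k < k
    wrapped<k = +-cancelʳ-< k _ k
      (subst (_< k + k) (sym (m∸n+n≡m k≤a+d)) (+-mono-<-≤ (Finₚ.toℕ<n a) d≤k))
    wrapped : toℕ a + d ∸ k ≡ toℕ b
    wrapped = <k⇒≈⇒≡ wrapped<k (Finₚ.toℕ<n b)
      (≈-trans (≈-sym (m+k≈m _)) (≈-trans (≈-reflexive (m∸n+n≡m k≤a+d)) e))

  pos : Vtx k → ℕ
  pos v = toℕ (proj₂ v)

  shift : Fin k → Vtx k → Vtx k
  shift r v = proj₁ v , proj₂ v ⊕ r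

  offset : Vtx k → Vtx k → Fin k
  offset v w = proj₂ w ⊕ ⊖ proj₂ v

  shift-≡ : ∀ {r v w} → proj₁ v ≡ proj₁ w → pos v + toℕ r ≈ pos w → shift r v ≡ w
  shift-≡ {r} {s , a} {.s , b} refl e = cong (s ,_) (toℕ-≈-injective (≈-trans (toℕ-⊕ a r) e))

  shift-≡⇒≈ : ∀ {r v w} → shift r v ≡ w → pos v + toℕ r ≈ pos w
  shift-≡⇒≈ {r} {s , a} refl = ≈-sym (toℕ-⊕ a r)

  shift-⊖-shift : ∀ r v → shift (⊖ r) (shift r v) ≡ v
  shift-⊖-shift r (s , a) = cong (s ,_) (⊕-⊖-cancel a r)

  shift-shift-⊖ : ∀ r v → shift r (shift (⊖ r) v) ≡ v
  shift-shift-⊖ r (s , a) = cong (s ,_) (⊕-⊖-cancel′ a r)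

  shift-⊖-from : ∀ {r v w} → shift r v ≡ w → shift (⊖ r) w ≡ v
  shift-⊖-from {r} {v} refl = shift-⊖-shift r v

  shift-⊖-to : ∀ {r v w} → shift (⊖ r) w ≡ v → shift r v ≡ w
  shift-⊖-to {r} {w = w} refl = shift-shift-⊖ r w

  shift-injectiveˡ : ∀ {r r′ v} → shift r v ≡ shift r′ v → r ≡ r′
  shift-injectiveˡ {r} {r′} {v} e = toℕ-≈-injective (≈-cancelˡ (pos v) (begin
    pos v + toℕ r         ≈⟨ shift-≡⇒≈ {r} {v} refl ⟩
    pos (shift r v)       ≡⟨ cong pos e ⟩
    pos (shift r′ v)      ≈⟨ shift-≡⇒≈ {r′} {v} refl ⟨
    pos v + toℕ r′        ∎))
    where open ≈-Reasoning

  shift-offset : ∀ {v w} → proj₁ v ≡ proj₁ w → shift (offset v w) v ≡ w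
  shift-offset {v} {w} e = shift-≡ {offset v w} {v} e (toℕ-+-⊖ (proj₂ v) (proj₂ w))

  AddMod-⊕ : ∀ {a d b} r → d ≤ k → AddMod k a d b → AddMod k (a ⊕ r) d (b ⊕ r)
  AddMod-⊕ {a} {d} {b} r d≤k step = ≈⇒AddMod d≤k (begin
    toℕ (a ⊕ r) + d      ≈⟨ +-congʳ (toℕ-⊕ a r) ⟩
    toℕ a + toℕ r + d    ≡⟨ xy∙z≈xz∙y (toℕ a) (toℕ r) d ⟩
    toℕ a + d + toℕ r    ≈⟨ +-congʳ (AddMod⇒≈ {a} {d} {b} step) ⟩
    toℕ b + toℕ r        ≈⟨ toℕ-⊕ b r ⟨
    toℕ (b ⊕ r)          ∎)
    where open ≈-Reasoning

  AddMod-offset : ∀ {a d b a′ b′} → AddMod k a d b → AddMod k a′ d b′ →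
                  toℕ b + toℕ (a′ ⊕ ⊖ a) ≈ toℕ b′
  AddMod-offset {a} {d} {b} {a′} {b′} step step′ = begin
    toℕ b + toℕ (a′ ⊕ ⊖ a)              ≈⟨ +-cong a+d≈b (≈-sym (toℕ-⊕ a′ (⊖ a))) ⟨
    (toℕ a + d) + (toℕ a′ + toℕ (⊖ a))  ≡⟨ shuffle (toℕ a) d (toℕ a′) _ ⟩
    (toℕ a + toℕ (⊖ a)) + (toℕ a′ + d)  ≈⟨ +-cong (+-⊖≈0 a) a′+d≈b′ ⟩
    toℕ b′                              ∎
    where
    open ≈-Reasoning
    a+d≈b = AddMod⇒≈ {a} {d} {b} step
    a′+d≈b′ = AddMod⇒≈ {a′} {d} {b′} step′
    shuffle : ∀ x y z w → (x + y) + (z + w) ≡ (x + w) + (z + y)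
    shuffle = solve-∀

  AddMod-functional : ∀ {a d d′ b} → AddMod k a d b → AddMod k a d′ b → d ≈ d′
  AddMod-functional {a} {d} {d′} {b} step step′ =
    ≈-cancelˡ (toℕ a) (≈-trans (AddMod⇒≈ {a} {d} {b} step) (≈-sym (AddMod⇒≈ {a} {d′} {b} step′)))

  AddMod-round-trip : ∀ {a d d′ b} → AddMod k a d b → AddMod k b d′ a → d + d′ ≈ 0
  AddMod-round-trip {a} {d} {d′} {b} there back = ≈-cancelˡ (toℕ a) (begin
    toℕ a + (d + d′)   ≡⟨ +-assoc (toℕ a) d d′ ⟨
    toℕ a + d + d′     ≈⟨ +-congʳ (AddMod⇒≈ {a} {d} {b} there) ⟩
    toℕ b + d′         ≈⟨ AddMod⇒≈ {b} {d′} {a} back ⟩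
    toℕ a              ≡⟨ +-identityʳ (toℕ a) ⟨
    toℕ a + 0          ∎)
    where open ≈-Reasoning

  reversing-translates⇒2d≈0 : ∀ {a b d r r′ c e} → AddMod k a d b →
    toℕ a + r ≈ c → toℕ b + r ≈ e → toℕ b + r′ ≈ c → toℕ a + r′ ≈ e → d + d ≈ 0
  reversing-translates⇒2d≈0 {a} {b} {d} {r} {r′} {c} {e} step ac be bc ae =
    ≈-cancelˡ (toℕ a + r) (begin
      toℕ a + r + (d + d)    ≡⟨ shuffle (toℕ a) r d ⟩
      toℕ a + d + r + d      ≈⟨ +-congʳ (+-congʳ a+d≈b) ⟩
      toℕ b + r + d          ≈⟨ +-congʳ be ⟩
      e + d                  ≈⟨ +-congʳ ae ⟨
      toℕ a + r′ + d         ≡⟨ xy∙z≈xz∙y (toℕ a) r′ d ⟩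
      toℕ a + d + r′         ≈⟨ +-congʳ a+d≈b ⟩
      toℕ b + r′             ≈⟨ bc ⟩
      c                      ≈⟨ ac ⟨
      toℕ a + r              ≡⟨ +-identityʳ (toℕ a + r) ⟨
      toℕ a + r + 0          ∎)
    where
    open ≈-Reasoning
    a+d≈b : toℕ a + d ≈ toℕ b
    a+d≈b = AddMod⇒≈ {a} {d} {b} step
    shuffle : ∀ x y z → x + y + (z + z) ≡ x + z + y + z
    shuffle = solve-∀

-- Difference classes of the edges of K_{4ℓ}, ℓ = m + 1

module DifferenceClasses (m : ℕ) where
  ℓ : ℕ
  ℓ = suc m

  k : ℕ
  k = 2 * ℓ

  open Modular k public

  k≡ℓ+ℓ : k ≡ ℓ + ℓ
  k≡ℓ+ℓ = cong (ℓ +_) (+-identityʳ ℓ)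

  ℓ≤k : ℓ ≤ k
  ℓ≤k = m≤m+n ℓ (ℓ + 0)

  0<x<k⇒x≉0 : ∀ {x} → 0 < x → x < k → ¬ (x ≈ 0)
  0<x<k⇒x≉0 0<x x<k x≈0 = <⇒≢ 0<x (sym (<k⇒≈⇒≡ x<k (≤-<-trans z≤n x<k) x≈0))

  -- The pure difference of length ℓ ∸ i is indexed by i, so that pure s zero is the long one.
  data Difference : Set where
    pure  : Side → Fin ℓ → Difference
    mixed : Fin k → Difference

  length : Fin ℓ → ℕ
  length i = ℓ ∸ toℕ i

  length-positive : ∀ i → 0 < length i
  length-positive i = m<n⇒0<n∸m (Finₚ.toℕ<n i)

  length≤ℓ : ∀ i → length i ≤ ℓ
  length≤ℓ i = m∸n≤m ℓ (toℕ i)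

  length<k : ∀ i → length i < k
  length<k i = ≤-<-trans (length≤ℓ i) (m<m+n ℓ (s≤s z≤n))

  length-injective : ∀ {i i′} → length i ≡ length i′ → i ≡ i′
  length-injective {i} {i′} e =
    Finₚ.toℕ-injective (∸-cancelˡ-≡ (<⇒≤ (Finₚ.toℕ<n i)) (<⇒≤ (Finₚ.toℕ<n i′)) e)

  Step : Difference → Vtx k → Vtx k → Set
  Step (pure s i) = PureStep s k (length i)
  Step (mixed d) = MixedStep k d

  HasDifference : Difference → Vtx k → Vtx k → Set
  HasDifference δ u v = Step δ u v ⊎ Step δ v u

  data IsShort : Difference → Set where
    pure-short  : ∀ s j → IsShort (pure s (Fin.suc j))
    mixed-short : ∀ d → IsShort (mixed d)

  -- Definitionally the predicate of hypothesis (ii), since length zero reduces to ℓ.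
  IsLongEdge : Vtx k → Vtx k → Set
  IsLongEdge u v = HasDifference (pure X Fin.zero) u v ⊎ HasDifference (pure Y Fin.zero) u v

  HasDifference⇒IsLongEdge : ∀ s {u v} → HasDifference (pure s Fin.zero) u v → IsLongEdge u v
  HasDifference⇒IsLongEdge X = inj₁
  HasDifference⇒IsLongEdge Y = inj₂

  HasDifference-pure-side : ∀ {s i u v} → HasDifference (pure s i) u v → proj₁ u ≡ s
  HasDifference-pure-side (inj₁ (pstep _)) = refl
  HasDifference-pure-side (inj₂ (pstep _)) = refl

  Step-shift : ∀ δ r {u v} → Step δ u v → Step δ (shift r u) (shift r v)
  Step-shift (pure s i) r (pstep step) = pstep (AddMod-⊕ r (<⇒≤ (length<k i)) step)
  Step-shift (mixed d) r (mstep step) = mstep (AddMod-⊕ r (<⇒≤ (Finₚ.toℕ<n d)) step)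

  HasDifference-shift : ∀ δ r {u v} → HasDifference δ u v → HasDifference δ (shift r u) (shift r v)
  HasDifference-shift δ r (inj₁ step) = inj₁ (Step-shift δ r step)
  HasDifference-shift δ r (inj₂ step) = inj₂ (Step-shift δ r step)

  Step-translate : ∀ δ {u v u′ v′} → Step δ u v → Step δ u′ v′ →
                   shift (offset u u′) u ≡ u′ × shift (offset u u′) v ≡ v′
  Step-translate (pure s i) {u} {v} {u′} (pstep {a} {b} step) (pstep {a′} {b′} step′) =
    shift-offset {u} {u′} refl ,
    shift-≡ {offset u u′} {v} refl (AddMod-offset {a} {length i} {b} {a′} {b′} step step′)
  Step-translate (mixed d) {u} {v} {u′} (mstep {a} {b} step) (mstep {a′} {b′} step′) =
    shift-offset {u} {u′} refl ,
    shift-≡ {offset u u′} {v} refl (AddMod-offset {a} {toℕ d} {b} {a′} {b′} step step′)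

  Step-functional : ∀ δ δ′ {u v} → Step δ u v → Step δ′ u v → δ ≡ δ′
  Step-functional (pure s i) (pure .s i′) (pstep step) (pstep step′) =
    cong (pure s) (length-injective (<k⇒≈⇒≡ (length<k i) (length<k i′) (AddMod-functional step step′)))
  Step-functional (mixed d) (mixed d′) (mstep step) (mstep step′) =
    cong mixed (toℕ-≈-injective (AddMod-functional step step′))

  d+d′≈0⇒d≡ℓ : ∀ {d d′} → 0 < d → d ≤ ℓ → d′ ≤ ℓ → d + d′ ≈ 0 → d ≡ ℓ
  d+d′≈0⇒d≡ℓ {d} {d′} 0<d d≤ℓ d′≤ℓ d+d′≈0 with d <? ℓ | d + d′ <? k
  ... | _ | yes d+d′<k = ⊥-elim (0<x<k⇒x≉0 (<-≤-trans 0<d (m≤m+n d d′)) d+d′<k d+d′≈0)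
  ... | yes d<ℓ | no d+d′≮k =
    ⊥-elim (d+d′≮k (subst (d + d′ <_) (sym k≡ℓ+ℓ) (+-mono-<-≤ d<ℓ d′≤ℓ)))
  ... | no d≮ℓ | _ = ≤-antisym d≤ℓ (≮⇒≥ d≮ℓ)

  Step-reverse : ∀ δ δ′ {u v} → Step δ u v → Step δ′ v u → δ ≡ δ′
  Step-reverse (pure s i) (pure .s i′) (pstep there) (pstep back) =
    cong (pure s) (length-injective (trans (is-ℓ i i′ round-trip) (sym (is-ℓ i′ i round-trip′))))
    where
    is-ℓ : ∀ i i′ → length i + length i′ ≈ 0 → length i ≡ ℓ
    is-ℓ i i′ = d+d′≈0⇒d≡ℓ (length-positive i) (length≤ℓ i) (length≤ℓ i′)
    round-trip = AddMod-round-trip there back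
    round-trip′ = AddMod-round-trip back there
  Step-reverse (mixed d) (mixed d′) (mstep _) ()

  HasDifference-unique : ∀ δ δ′ {u v} → HasDifference δ u v → HasDifference δ′ u v → δ ≡ δ′
  HasDifference-unique δ δ′ (inj₁ step) (inj₁ step′) = Step-functional δ δ′ step step′
  HasDifference-unique δ δ′ (inj₁ step) (inj₂ step′) = Step-reverse δ δ′ step step′
  HasDifference-unique δ δ′ (inj₂ step) (inj₁ step′) = sym (Step-reverse δ′ δ step′ step)
  HasDifference-unique δ δ′ (inj₂ step) (inj₂ step′) = Step-functional δ δ′ step step′

  pure-step-of-length : ∀ s {a b} e → 0 < e → e ≤ ℓ → toℕ a + e ≈ toℕ b →
                        Σ (Fin ℓ) λ i → Step (pure s i) (s , a) (s , b)
  pure-step-of-length s {a} {b} e 0<e e≤ℓ a+e≈b =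
    i , pstep (subst (λ d → AddMod k a d b) (sym length-i) (≈⇒AddMod (≤-trans e≤ℓ ℓ≤k) a+e≈b))
    where
    ℓ∸e<ℓ : ℓ ∸ e < ℓ
    ℓ∸e<ℓ = ∸-monoʳ-< 0<e e≤ℓ
    i : Fin ℓ
    i = fromℕ< ℓ∸e<ℓ
    length-i : length i ≡ e
    length-i = trans (cong (ℓ ∸_) (Finₚ.toℕ-fromℕ< ℓ∸e<ℓ)) (m∸[m∸n]≡n e≤ℓ)

  pure-difference-of-offset : ∀ s {a b} e → 0 < e → e < k → toℕ a + e ≈ toℕ b →
                              Σ (Fin ℓ) λ i → HasDifference (pure s i) (s , a) (s , b)
  pure-difference-of-offset s {a} {b} e 0<e e<k a+e≈b with e ≤? ℓ
  ... | yes e≤ℓ = map₂ inj₁ (pure-step-of-length s e 0<e e≤ℓ a+e≈b)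
  ... | no e≰ℓ = map₂ inj₂ (pure-step-of-length s (k ∸ e) 0<k∸e k∸e≤ℓ b+k∸e≈a)
    where
    0<k∸e : 0 < k ∸ e
    0<k∸e = m<n⇒0<n∸m e<k
    k∸e≤ℓ : k ∸ e ≤ ℓ
    k∸e≤ℓ = subst (k ∸ e ≤_) (trans (cong (_∸ ℓ) k≡ℓ+ℓ) (m+n∸m≡n ℓ ℓ))
                  (∸-monoʳ-≤ k (<⇒≤ (≰⇒> e≰ℓ)))
    b+k∸e≈a : toℕ b + (k ∸ e) ≈ toℕ a
    b+k∸e≈a = begin
      toℕ b + (k ∸ e)          ≈⟨ +-congʳ a+e≈b ⟨
      toℕ a + e + (k ∸ e)      ≡⟨ +-assoc (toℕ a) e (k ∸ e) ⟩
      toℕ a + (e + (k ∸ e))    ≡⟨ cong (toℕ a +_) (m+[n∸m]≡n (<⇒≤ e<k)) ⟩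
      toℕ a + k                ≈⟨ m+k≈m (toℕ a) ⟩
      toℕ a                    ∎
      where open ≈-Reasoning

  pure-difference : ∀ s {a b : Fin k} → a ≢ b → Σ (Fin ℓ) λ i → HasDifference (pure s i) (s , a) (s , b)
  pure-difference s {a} {b} a≢b =
    pure-difference-of-offset s (toℕ (b ⊕ ⊖ a)) 0<e (Finₚ.toℕ<n (b ⊕ ⊖ a)) (toℕ-+-⊖ a b)
    where
    0<e : 0 < toℕ (b ⊕ ⊖ a)
    0<e = n≢0⇒n>0 λ e≡0 → a≢b (toℕ-≈-injective (≈-trans
      (≈-reflexive (sym (trans (cong (toℕ a +_) e≡0) (+-identityʳ (toℕ a))))) (toℕ-+-⊖ a b)))

  difference : ∀ u v → u ≢ v → Σ Difference λ δ → HasDifference δ u v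
  difference (X , a) (Y , b) _ =
    mixed (b ⊕ ⊖ a) , inj₁ (mstep (≈⇒AddMod (<⇒≤ (Finₚ.toℕ<n (b ⊕ ⊖ a))) (toℕ-+-⊖ a b)))
  difference (Y , a) (X , b) _ =
    mixed (a ⊕ ⊖ b) , inj₂ (mstep (≈⇒AddMod (<⇒≤ (Finₚ.toℕ<n (a ⊕ ⊖ b))) (toℕ-+-⊖ b a)))
  difference (X , a) (X , b) u≢v with pure-difference X (u≢v ∘ cong (X ,_))
  ... | i , h = pure X i , h
  difference (Y , a) (Y , b) u≢v with pure-difference Y (u≢v ∘ cong (Y ,_))
  ... | i , h = pure Y i , h

  IsShort⇒≢long : ∀ {δ} s → IsShort δ → δ ≢ pure s Fin.zero
  IsShort⇒≢long s (pure-short _ _) ()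
  IsShort⇒≢long s (mixed-short _) ()

  -- Reversing translates force 2d ≈ 0; short pure lengths have 0 < 2d < k, and mixed steps change side.
  short-step-not-reversible : ∀ {δ u v r r′ w z} → IsShort δ → Step δ u v →
    shift r u ≡ w → shift r v ≡ z → shift r′ v ≡ w → shift r′ u ≡ z → ⊥
  short-step-not-reversible {r = r} {r′} (pure-short s j) (pstep {a} {b} step) ru rv r′v r′u =
    0<x<k⇒x≉0 (+-mono-< (length-positive (Fin.suc j)) (length-positive (Fin.suc j))) 2d<k
      (reversing-translates⇒2d≈0 {a} {b} step (shift-≡⇒≈ {r} ru) (shift-≡⇒≈ {r} rv)
                                              (shift-≡⇒≈ {r′} r′v) (shift-≡⇒≈ {r′} r′u))
    where
    d≤m : length (Fin.suc j) ≤ m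
    d≤m = m∸n≤m m (toℕ j)
    2d<k : length (Fin.suc j) + length (Fin.suc j) < k
    2d<k = s≤s (≤-trans (+-mono-≤ d≤m d≤m) (+-monoʳ-≤ m (≤-trans (n≤1+n m) (m≤m+n ℓ 0))))
  short-step-not-reversible (mixed-short d) (mstep _) ru _ r′v _ = X≢Y (cong proj₁ (trans ru (sym r′v)))
    where
    X≢Y : X ≢ Y
    X≢Y ()

  short-edge-not-reversible : ∀ {δ u v r r′ w z} → IsShort δ → HasDifference δ u v →
    shift r u ≡ w → shift r v ≡ z → shift r′ v ≡ w → shift r′ u ≡ z → ⊥
  short-edge-not-reversible short (inj₁ step) ru rv r′v r′u =
    short-step-not-reversible short step ru rv r′v r′u
  short-edge-not-reversible short (inj₂ step) ru rv r′v r′u =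
    short-step-not-reversible short step r′v r′u ru rv

  HasDifference-translate : ∀ δ {u v w z} → HasDifference δ u v → HasDifference δ w z →
    Σ (Fin k) λ r → (shift r u ≡ w × shift r v ≡ z) ⊎ (shift r v ≡ w × shift r u ≡ z)
  HasDifference-translate δ (inj₁ uv) (inj₁ wz) = _ , inj₁ (Step-translate δ uv wz)
  HasDifference-translate δ (inj₁ uv) (inj₂ zw) = _ , inj₂ (×-swap (Step-translate δ uv zw))
  HasDifference-translate δ (inj₂ vu) (inj₁ wz) = _ , inj₂ (Step-translate δ vu wz)
  HasDifference-translate δ (inj₂ vu) (inj₂ zw) = _ , inj₁ (×-swap (Step-translate δ vu zw))

  long-edge-side : ∀ {s u v} → HasDifference (pure s Fin.zero) u v → proj₁ v ≡ proj₁ u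
  long-edge-side (inj₁ (pstep _)) = refl
  long-edge-side (inj₂ (pstep _)) = refl

  -- Since ℓ + ℓ = k, both orientations of a long edge step by ℓ.
  long-edge-≈ : ∀ {s u v} → HasDifference (pure s Fin.zero) u v → pos u + ℓ ≈ pos v
  long-edge-≈ (inj₁ (pstep {a} {b} step)) = AddMod⇒≈ {a} {ℓ} {b} step
  long-edge-≈ (inj₂ (pstep {a} {b} step)) = begin
    toℕ b + ℓ        ≈⟨ +-congʳ (AddMod⇒≈ {a} {ℓ} {b} step) ⟨
    toℕ a + ℓ + ℓ    ≡⟨ trans (+-assoc (toℕ a) ℓ ℓ) (cong (toℕ a +_) (sym k≡ℓ+ℓ)) ⟩
    toℕ a + k        ≈⟨ m+k≈m (toℕ a) ⟩
    toℕ a            ∎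
    where open ≈-Reasoning

  long-edge-shift : ∀ {s s′ u v u′ v′ r} → HasDifference (pure s Fin.zero) u v →
    HasDifference (pure s′ Fin.zero) u′ v′ → shift r u ≡ u′ → shift r v ≡ v′
  long-edge-shift {u = u} {v} {u′} {v′} {r} long long′ ru =
    shift-≡ {r} {v} (trans (long-edge-side long) (trans (cong proj₁ ru) (sym (long-edge-side long′)))) (begin
      pos v + toℕ r        ≈⟨ +-congʳ (long-edge-≈ long) ⟨
      pos u + ℓ + toℕ r    ≡⟨ xy∙z≈xz∙y (pos u) ℓ (toℕ r) ⟩
      pos u + toℕ r + ℓ    ≈⟨ +-congʳ (shift-≡⇒≈ {r} {u} ru) ⟩
      pos u′ + ℓ           ≈⟨ long-edge-≈ long′ ⟩
      pos v′               ∎)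
    where open ≈-Reasoning

  Difference↔Fin : Difference ↔ Fin (2 * k)
  Difference↔Fin = subst (λ n → Difference ↔ Fin n) (cong (k +_) (sym (+-identityʳ k))) (↔-trans
    (mk↔ₛ′ split join (λ { (inj₁ (s , i)) → refl ; (inj₂ d) → refl })
                      (λ { (pure s i) → refl ; (mixed d) → refl }))
    (↔-trans (Vtx↔Fin ℓ ⊎-↔ ↔-refl) (↔-sym Finₚ.+↔⊎)))
    where
    split : Difference → (Side × Fin ℓ) ⊎ Fin k
    split (pure s i) = inj₁ (s , i)
    split (mixed d) = inj₂ d
    join : (Side × Fin ℓ) ⊎ Fin k → Difference
    join (inj₁ (s , i)) = pure s i
    join (inj₂ d) = mixed d

module Construction (m : ℕ)
  (F₁ F₂ : Vtx (2 * suc m) → Vtx (2 * suc m))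
  (F₁-matching : IsOneFactor F₁) (F₂-matching : IsOneFactor F₂)
  (pure-once : ∀ d → 1 ≤ d → d ≤ suc m →
     ExactlyOneEdge (InUnion F₁ F₂) (PureLength X (2 * suc m) d) ×
     ExactlyOneEdge (InUnion F₁ F₂) (PureLength Y (2 * suc m) d))
  (mixed-once : ∀ d → ExactlyOneEdge (InUnion F₁ F₂) (MixedDiff (2 * suc m) d))
  (F₁-long-once : ExactlyOneEdge (InFactor F₁) (DifferenceClasses.IsLongEdge m))
  (F₂-long-once : ExactlyOneEdge (InFactor F₂) (DifferenceClasses.IsLongEdge m)) where

  open DifferenceClasses m

  V : Set
  V = Vtx k

  F : Bool → V → V
  F true = F₁
  F false = F₂

  F-matching : ∀ j → IsOneFactor (F j)
  F-matching true = F₁-matching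
  F-matching false = F₂-matching

  F-involutive : ∀ j v → F j (F j v) ≡ v
  F-involutive j = proj₁ (F-matching j)

  F-fixpoint-free : ∀ j v → F j v ≢ v
  F-fixpoint-free j = proj₂ (F-matching j)

  F-sym : ∀ j {u v} → F j u ≡ v → F j v ≡ u
  F-sym j {u} refl = F-involutive j u

  F-long-once : ∀ j → ExactlyOneEdge (InFactor (F j)) IsLongEdge
  F-long-once true = F₁-long-once
  F-long-once false = F₂-long-once

  union-factor : ∀ {u v} → InUnion F₁ F₂ u v → Σ Bool λ j → F j u ≡ v
  union-factor (inj₁ e) = true , e
  union-factor (inj₂ e) = false , e

  factor-union : ∀ j {u v} → F j u ≡ v → InUnion F₁ F₂ u v
  factor-union true = inj₁
  factor-union false = inj₂

  difference-once : ∀ δ → ExactlyOneEdge (InUnion F₁ F₂) (HasDifference δ)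
  difference-once (pure X i) = proj₁ (pure-once (length i) (length-positive i) (length≤ℓ i))
  difference-once (pure Y i) = proj₂ (pure-once (length i) (length-positive i) (length≤ℓ i))
  difference-once (mixed d) = mixed-once d

  record LongEdge (j : Bool) : Set where
    field
      side : Side
      p q : V
      step : Step (pure side Fin.zero) p q
      F-p : F j p ≡ q
      endpoint : ∀ x y → F j x ≡ y → IsLongEdge x y → x ≡ p ⊎ x ≡ q

  IsLongEdge-side : ∀ {u v} → IsLongEdge u v → Σ Side λ s → HasDifference (pure s Fin.zero) u v
  IsLongEdge-side (inj₁ h) = X , h
  IsLongEdge-side (inj₂ h) = Y , h

  long-edge : ∀ j → LongEdge j
  long-edge j with F-long-once j
  ... | (u , v , F-u , long) , once with IsLongEdge-side long
  ...   | s , inj₁ step = record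
    { side = s ; p = u ; q = v ; step = step ; F-p = F-u
    ; endpoint = λ x y F-x long′ → Sum.map proj₁ proj₁ (once x y u v F-x long′ F-u long) }
  ...   | s , inj₂ step = record
    { side = s ; p = v ; q = u ; step = step ; F-p = F-sym j F-u
    ; endpoint = λ x y F-x long′ →
        Sum.swap (Sum.map proj₁ proj₁ (once x y u v F-x long′ F-u long)) }

  long-side : Bool → Side
  long-side j = LongEdge.side (long-edge j)

  p q : Bool → V
  p j = LongEdge.p (long-edge j)
  q j = LongEdge.q (long-edge j)

  long-step : ∀ j → Step (pure (long-side j) Fin.zero) (p j) (q j)
  long-step j = LongEdge.step (long-edge j)

  F-p : ∀ j → F j (p j) ≡ q j
  F-p j = LongEdge.F-p (long-edge j)

  F-q : ∀ j → F j (q j) ≡ p j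
  F-q j = F-sym j (F-p j)

  p≢q : ∀ j → p j ≢ q j
  p≢q j p≡q = F-fixpoint-free j (p j) (trans (F-p j) (sym p≡q))

  p-side : ∀ j → proj₁ (p j) ≡ long-side j
  p-side j = PureStep-source-side (long-step j)

  q-side : ∀ j → proj₁ (q j) ≡ long-side j
  q-side j = PureStep-target-side (long-step j)

  long-endpoint : ∀ j {x y} → F j x ≡ y → IsLongEdge x y → x ≡ p j ⊎ x ≡ q j
  long-endpoint j = LongEdge.endpoint (long-edge j) _ _

  long-side-surjective : ∀ s → Σ Bool λ j → long-side j ≡ s
  long-side-surjective s with difference-once (pure s Fin.zero)
  ... | (u , v , in-union , long) , _ with union-factor in-union
  ...   | j , F-u = j , trans (sym (endpoint-side (long-endpoint j F-u (HasDifference⇒IsLongEdge s long))))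
                              (HasDifference-pure-side {i = Fin.zero} long)
    where
    endpoint-side : u ≡ p j ⊎ u ≡ q j → proj₁ u ≡ long-side j
    endpoint-side (inj₁ refl) = p-side j
    endpoint-side (inj₂ refl) = q-side j

  long-sides-differ : long-side true ≢ long-side false
  long-sides-differ same with long-side-surjective (other (long-side true))
  ... | true , e = other≢ (long-side true) e
  ... | false , e = other≢ (long-side true) (trans same e)

  long-side-injective : ∀ j j′ → long-side j ≡ long-side j′ → j ≡ j′
  long-side-injective true true _ = refl
  long-side-injective false false _ = refl
  long-side-injective true false same = ⊥-elim (long-sides-differ same)
  long-side-injective false true same = ⊥-elim (long-sides-differ (sym same))

  record Representative (δ : Difference) : Set where
    field
      factor : Bool
      start end : V
      F-start : F factor start ≡ end
      has-difference : HasDifference δ start end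

  representative : ∀ δ → Representative δ
  representative δ with difference-once δ
  ... | (u , v , in-union , h) , _ =
    record { factor = proj₁ (union-factor in-union) ; start = u ; end = v
           ; F-start = proj₂ (union-factor in-union) ; has-difference = h }

  module _ (δ : Difference) where
    open Representative (representative δ)

    rep-factor : Bool
    rep-factor = factor

    rep-end : Bool → V
    rep-end true = start
    rep-end false = end

    rep-HasDifference : ∀ c → HasDifference δ (rep-end c) (F factor (rep-end c))
    rep-HasDifference true = subst (HasDifference δ start) (sym F-start) has-difference
    rep-HasDifference false = subst (HasDifference δ end) (sym (F-sym factor F-start)) (Sum.swap has-difference)

    rep-end-injective : ∀ {c c′} → rep-end c ≡ rep-end c′ → c ≡ c′
    rep-end-injective {true} {true} _ = refl
    rep-end-injective {false} {false} _ = refl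
    rep-end-injective {true} {false} e = ⊥-elim (F-fixpoint-free factor start (trans F-start (sym e)))
    rep-end-injective {false} {true} e = ⊥-elim (F-fixpoint-free factor start (trans F-start e))

  incidence : Difference × Bool → V × Bool
  incidence (δ , c) = rep-end δ c , rep-factor δ

  incidence-injective : Injective _≡_ _≡_ incidence
  incidence-injective {δ , c} {δ′ , c′} e with HasDifference-unique δ δ′ (rep-HasDifference δ c)
    (subst₂ (λ w j → HasDifference δ′ w (F j w)) (sym (cong proj₁ e)) (sym (cong proj₂ e))
            (rep-HasDifference δ′ c′))
  ... | refl = cong (δ ,_) (rep-end-injective δ (cong proj₁ e))

  -- The 2k differences times two endpoints give 4k distinct incidences (vertex, factor): all of them.
  -- An edge lying in both factors would leave one of its incidences unused.
  F-disjoint : ∀ {x y} → F true x ≡ y → F false x ≡ y → ⊥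
  F-disjoint {x} {y} F₁-xy F₂-xy =
    ↔-injective-misses-nothing (×Bool↔Fin Difference↔Fin) (×Bool↔Fin (Vtx↔Fin k))
      incidence incidence-injective (x , not (rep-factor δ₀)) missed
    where
    F-xy : ∀ j → F j x ≡ y
    F-xy true = F₁-xy
    F-xy false = F₂-xy
    classified = difference x y λ x≡y → F-fixpoint-free true x (trans F₁-xy (sym x≡y))
    δ₀ = proj₁ classified
    missed : ∀ a → incidence a ≢ (x , not (rep-factor δ₀))
    missed (δ , c) e = not-¬ refl (trans (cong rep-factor (sym δ≡δ₀)) (cong proj₂ e))
      where
      δ≡δ₀ : δ ≡ δ₀
      δ≡δ₀ = HasDifference-unique δ δ₀
        (subst₂ (HasDifference δ) (cong proj₁ e) (trans (cong (F (rep-factor δ)) (cong proj₁ e)) (F-xy _))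
          (rep-HasDifference δ c))
        (proj₂ classified)

  F-index-unique : ∀ j j′ {x y} → F j x ≡ y → F j′ x ≡ y → j ≡ j′
  F-index-unique true true _ _ = refl
  F-index-unique false false _ _ = refl
  F-index-unique true false e e′ = ⊥-elim (F-disjoint e e′)
  F-index-unique false true e e′ = ⊥-elim (F-disjoint e′ e)

  -- F j with its long edge p q replaced by the directed triangle ∞ → p → q → ∞, where ∞ = nothing.
  base-factor : Bool → Maybe V → Maybe V
  base-factor j nothing = just (p j)
  base-factor j (just w) with w ≟Vtx q j
  ... | yes _ = nothing
  ... | no _ = just (F j w)

  base-factor-q : ∀ j → base-factor j (just (q j)) ≡ nothing
  base-factor-q j with q j ≟Vtx q j
  ... | yes _ = refl
  ... | no q≢q = ⊥-elim (q≢q refl)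

  base-factor-≢q : ∀ j {w} → w ≢ q j → base-factor j (just w) ≡ just (F j w)
  base-factor-≢q j {w} w≢q with w ≟Vtx q j
  ... | yes w≡q = ⊥-elim (w≢q w≡q)
  ... | no _ = refl

  base-factor-to-∞ : ∀ j w → base-factor j (just w) ≡ nothing → w ≡ q j
  base-factor-to-∞ j w e with w ≟Vtx q j
  ... | yes w≡q = w≡q

  base-factor-arc : ∀ j w {z} → base-factor j (just w) ≡ just z → F j w ≡ z × w ≢ q j
  base-factor-arc j w e with w ≟Vtx q j
  ... | no w≢q = just-injective e , w≢q

  base-factor-is-C2C3 : ∀ j → IsC2C3FactorOn (Maybe V) (base-factor j)
  base-factor-is-C2C3 j =
    nothing , just (p j) , just (q j) , (λ ()) , p≢q j ∘ just-injective , (λ ()) ,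
    refl , trans (base-factor-≢q j (p≢q j)) (cong just (F-p j)) , base-factor-q j , two-cycle
    where
    two-cycle : ∀ v → v ≢ nothing → v ≢ just (p j) → v ≢ just (q j) →
                (base-factor j v ≢ v) × (base-factor j (base-factor j v) ≡ v)
    two-cycle nothing v≢∞ _ _ = ⊥-elim (v≢∞ refl)
    two-cycle (just w) _ w≢p w≢q =
      (λ e → F-fixpoint-free j w (just-injective (trans (sym step₁) e))) ,
      trans (cong (base-factor j) step₁) (trans (base-factor-≢q j Fw≢q) (cong just (F-involutive j w)))
      where
      step₁ : base-factor j (just w) ≡ just (F j w)
      step₁ = base-factor-≢q j (w≢q ∘ cong just)
      Fw≢q : F j w ≢ q j
      Fw≢q e = w≢p (cong just (trans (sym (F-involutive j w)) (trans (cong (F j) e) (F-q j))))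

  translation↔ : Fin k → Maybe V ↔ Maybe V
  translation↔ r = mk↔ₛ′ (Maybe.map (shift r)) (Maybe.map (shift (⊖ r))) there-back back-there
    where
    there-back : ∀ x → Maybe.map (shift r) (Maybe.map (shift (⊖ r)) x) ≡ x
    there-back nothing = refl
    there-back (just v) = cong just (shift-shift-⊖ r v)
    back-there : ∀ x → Maybe.map (shift (⊖ r)) (Maybe.map (shift r) x) ≡ x
    back-there nothing = refl
    back-there (just v) = cong just (shift-⊖-shift r v)

  Translate : Set
  Translate = Bool × Fin k

  translate : Translate → Maybe V → Maybe V
  translate (j , r) = Inverse.to (translation↔ r) ∘ base-factor j ∘ Inverse.from (translation↔ r)

  translate-is-C2C3 : ∀ i → IsC2C3FactorOn (Maybe V) (translate i)
  translate-is-C2C3 (j , r) = IsC2C3FactorOn-conjugate (translation↔ r) (base-factor-is-C2C3 j)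

  translate-arc : ∀ j r {x y w z} → F j x ≡ y → x ≢ q j → shift r x ≡ w → shift r y ≡ z →
                  translate (j , r) (just w) ≡ just z
  translate-arc j r {x} {y} F-xy x≢q refl refl = begin
    Maybe.map (shift r) (base-factor j (just (shift (⊖ r) (shift r x))))
      ≡⟨ cong (λ x′ → Maybe.map (shift r) (base-factor j (just x′))) (shift-⊖-shift r x) ⟩
    Maybe.map (shift r) (base-factor j (just x))
      ≡⟨ cong (Maybe.map (shift r)) (base-factor-≢q j x≢q) ⟩
    just (shift r (F j x))
      ≡⟨ cong (just ∘ shift r) F-xy ⟩
    just (shift r y) ∎
    where open ≡-Reasoning

  translate-arc⇒ : ∀ j r {w z} → translate (j , r) (just w) ≡ just z →
                   F j (shift (⊖ r) w) ≡ shift (⊖ r) z × shift (⊖ r) w ≢ q j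
  translate-arc⇒ j r {w} e with base-factor j (just (shift (⊖ r) w)) in eq
  ... | just z′ with base-factor-arc j _ eq
  ...   | F-w , w≢q = trans F-w (sym (shift-⊖-from (just-injective e))) , w≢q

  translate-to-∞ : ∀ j r {w} → shift r (q j) ≡ w → translate (j , r) (just w) ≡ nothing
  translate-to-∞ j r refl = trans
    (cong (Maybe.map (shift r) ∘ base-factor j ∘ just) (shift-⊖-shift r (q j)))
    (cong (Maybe.map (shift r)) (base-factor-q j))

  translate-to-∞⇒ : ∀ j r {w} → translate (j , r) (just w) ≡ nothing → shift r (q j) ≡ w
  translate-to-∞⇒ j r {w} e with base-factor j (just (shift (⊖ r) w)) in eq
  ... | nothing = shift-⊖-to {r} {q j} {w} (base-factor-to-∞ j (shift (⊖ r) w) eq)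

  CoveredOnce : Maybe V → Maybe V → Set
  CoveredOnce u v =
    Σ Translate (λ i → translate i u ≡ v) ×
    (∀ i i′ → translate i u ≡ v → translate i′ u ≡ v → i ≡ i′)

  module Anchored (t : Bool → V) (t-side : ∀ j → proj₁ (t j) ≡ long-side j) where

    anchored-translate : ∀ w → Σ Translate λ (j , r) → shift r (t j) ≡ w
    anchored-translate w = (j , offset (t j) w) , shift-offset {t j} {w} (trans (t-side j) j-side)
      where
      j = proj₁ (long-side-surjective (proj₁ w))
      j-side = proj₂ (long-side-surjective (proj₁ w))

    anchored-translate-unique : ∀ {j r j′ r′ w} → shift r (t j) ≡ w → shift r′ (t j′) ≡ w →
                                (j , r) ≡ (j′ , r′)
    anchored-translate-unique {j} {r} {j′} {r′} e e′ =
      cong₂ _,_ j≡j′ (shift-injectiveˡ {r} {r′} {t j} (trans e (trans (sym e′) (cong (shift r′ ∘ t) (sym j≡j′)))))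
      where
      j≡j′ = long-side-injective j j′ (trans (sym (t-side j)) (trans (cong proj₁ (trans e (sym e′))) (t-side j′)))

  open Anchored

  arcs-from-∞ : ∀ w → CoveredOnce nothing (just w)
  arcs-from-∞ w =
    map₂ (cong just) (anchored-translate p p-side w) ,
    λ i i′ e e′ → anchored-translate-unique p p-side (just-injective e) (just-injective e′)

  arcs-to-∞ : ∀ w → CoveredOnce (just w) nothing
  arcs-to-∞ w =
    (i , translate-to-∞ (proj₁ i) (proj₂ i) e) ,
    λ (j , r) (j′ , r′) e e′ →
      anchored-translate-unique q q-side (translate-to-∞⇒ j r {w} e) (translate-to-∞⇒ j′ r′ {w} e′)
    where
    i = proj₁ (anchored-translate q q-side w)
    e = proj₂ (anchored-translate q q-side w)

  long-arcs : ∀ {s w z} → HasDifference (pure s Fin.zero) w z → CoveredOnce (just w) (just z)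
  long-arcs {s} {w} {z} h =
    ((j , r) , translate-arc j r (F-p j) (p≢q j) p↦w (long-edge-shift (inj₁ (long-step j)) h p↦w)) ,
    λ (j , r) (j′ , r′) e e′ → anchored-translate-unique p p-side (p-anchor j r e) (p-anchor j′ r′ e′)
    where
    j = proj₁ (proj₁ (anchored-translate p p-side w))
    r = proj₂ (proj₁ (anchored-translate p p-side w))
    p↦w = proj₂ (anchored-translate p p-side w)
    p-anchor : ∀ j r → translate (j , r) (just w) ≡ just z → shift r (p j) ≡ w
    p-anchor j r e with translate-arc⇒ j r {w} {z} e
    ... | F-w′ , w′≢q
      with long-endpoint j F-w′ (HasDifference⇒IsLongEdge s (HasDifference-shift (pure s Fin.zero) (⊖ r) h))
    ...   | inj₁ w′≡p = shift-⊖-to {r} {p j} {w} w′≡p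
    ...   | inj₂ w′≡q = ⊥-elim (w′≢q w′≡q)

  short-arc-avoids-q : ∀ {δ j x y} → IsShort δ → F j x ≡ y → HasDifference δ x y → x ≢ q j
  short-arc-avoids-q {δ} {j} short F-xy h refl =
    IsShort⇒≢long (long-side j) short
      (HasDifference-unique δ long h (subst (HasDifference long (q j)) q↦p (inj₂ (long-step j))))
    where
    long = pure (long-side j) Fin.zero
    q↦p = trans (sym (F-q j)) F-xy

  short-arcs : ∀ {δ w z} → IsShort δ → HasDifference δ w z → CoveredOnce (just w) (just z)
  short-arcs {δ} {w} {z} short h = existence , uniqueness
    where
    open Representative (representative δ)
      renaming (factor to j; start to u; end to v; F-start to F-uv; has-difference to h₀)
    existence : Σ Translate λ i → translate i (just w) ≡ just z
    existence with HasDifference-translate δ h₀ h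
    ... | r , inj₁ (u↦w , v↦z) =
      (j , r) , translate-arc j r F-uv (short-arc-avoids-q short F-uv h₀) u↦w v↦z
    ... | r , inj₂ (v↦w , u↦z) =
      (j , r) , translate-arc j r (F-sym j F-uv) (short-arc-avoids-q short (F-sym j F-uv) (Sum.swap h₀)) v↦w u↦z
    uniqueness : ∀ i i′ → translate i (just w) ≡ just z → translate i′ (just w) ≡ just z → i ≡ i′
    uniqueness (j , r) (j′ , r′) e e′
      with translate-arc⇒ j r {w} {z} e | translate-arc⇒ j′ r′ {w} {z} e′
    ... | F-w₁ , _ | F-w₂ , _
      with proj₂ (difference-once δ) _ _ _ _ (factor-union j F-w₁) (HasDifference-shift δ (⊖ r) h)
                                              (factor-union j′ F-w₂) (HasDifference-shift δ (⊖ r′) h)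
    ... | inj₁ (w₁≡w₂ , z₁≡z₂) =
      cong₂ _,_ (F-index-unique j j′ F-w₁ (subst₂ (λ a b → F j′ a ≡ b) (sym w₁≡w₂) (sym z₁≡z₂) F-w₂))
                (⊖-injective (shift-injectiveˡ {⊖ r} {⊖ r′} {w} w₁≡w₂))
    ... | inj₂ (w₁≡z₂ , z₁≡w₂) = ⊥-elim (short-edge-not-reversible short (HasDifference-shift δ (⊖ r) h)
      (shift-shift-⊖ r w) (shift-shift-⊖ r z)
      (shift-⊖-to {r′} {_} {w} (sym z₁≡w₂)) (shift-⊖-to {r′} {_} {z} (sym w₁≡z₂)))

  translates-partition : ArcPartition (Maybe V) Translate translate
  translates-partition nothing nothing ∞≢∞ = ⊥-elim (∞≢∞ refl)
  translates-partition nothing (just w) _ = arcs-from-∞ w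
  translates-partition (just w) nothing _ = arcs-to-∞ w
  translates-partition (just w) (just z) w≢z with difference w z (w≢z ∘ cong just)
  ... | pure s Fin.zero , h = long-arcs h
  ... | pure s (Fin.suc j) , h = short-arcs (pure-short s j) h
  ... | mixed d , h = short-arcs (mixed-short d) h

  points↔Fin : Maybe V ↔ Fin (4 * ℓ + 1)
  points↔Fin = subst (λ n → Maybe V ↔ Fin n) (count ℓ) (Maybe↔Fin (Vtx↔Fin k))
    where
    count : ∀ n → suc (2 * (2 * n)) ≡ 4 * n + 1
    count = solve-∀

  translates↔Fin : Translate ↔ Fin (2 * k)
  translates↔Fin = ↔-trans (↔-sym Finₚ.2↔Bool ×-↔ ↔-refl) (↔-sym Finₚ.*↔×)

lemma3p7 : (ℓ : ℕ) → 1 ≤ ℓ →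
    (F₁ F₂ : Vtx (2 * ℓ) → Vtx (2 * ℓ)) →
    IsOneFactor F₁ → IsOneFactor F₂ →
    (∀ d → 1 ≤ d → d ≤ ℓ →
       ExactlyOneEdge (InUnion F₁ F₂) (PureLength X (2 * ℓ) d) ×
       ExactlyOneEdge (InUnion F₁ F₂) (PureLength Y (2 * ℓ) d)) →
    (∀ (d : Fin (2 * ℓ)) → ExactlyOneEdge (InUnion F₁ F₂) (MixedDiff (2 * ℓ) d)) →
    ExactlyOneEdge (InFactor F₁) (λ u v → PureLength X (2 * ℓ) ℓ u v ⊎ PureLength Y (2 * ℓ) ℓ u v) →
    ExactlyOneEdge (InFactor F₂) (λ u v → PureLength X (2 * ℓ) ℓ u v ⊎ PureLength Y (2 * ℓ) ℓ u v) →
    C2C3Factorization (4 * ℓ + 1)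
lemma3p7 zero ()
lemma3p7 (suc m) _ F₁ F₂ F₁-matching F₂-matching pure-once mixed-once F₁-long-once F₂-long-once =
  C2C3Factorization-transport points↔Fin translates↔Fin translate translate-is-C2C3 translates-partition
  where
  open Construction m F₁ F₂ F₁-matching F₂-matching pure-once mixed-once F₁-long-once F₂-long-once
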